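{- Let $M_k$ denote a matching with $k$ edges. For all positive integers $k$ and $n$ with $n\ge 9k^2$, \[ \mathrm{ex}^*(n,M_k)=\binom{k-1}{2}+(k-1)(n-k+1). \]
   Context: For a fixed graph $F$, $\mathrm{ex}^*(n,F)$ (the rainbow Turán number of $F$) is the maximum number of edges in a graph on $n$ vertices that admits a proper edge-coloring containing no rainbow copy of $F$. A rainbow copy of $F$ is a copy of $F$ all of whose edges receive different colors. -}

module Defs where

open import Data.Nat using (ℕ; zero; suc; _+_; _*_; _∸_; _≤_; _<_)
open import Data.Nat.Combinatorics using (_C_)
open import Data.Fin using (Fin; toℕ)
open import Data.Bool using (Bool; true; false)
open import Data.Product using (Σ; _×_; _,_; proj₁; proj₂; ∃-syntax)
open import Relation.Nullary using (¬_)
open import Relation.Binary.PropositionalEquality using (_≡_; _≢_)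
open import Data.Vec.Functional using (Vector)
import Data.Vec.Functional as VF

record Graph (n : ℕ) : Set where
  field
    adj   : Fin n → Fin n → Bool
    sym   : ∀ u v → adj u v ≡ adj v u
    irref : ∀ u → adj u u ≡ false
open Graph public

Edge : ∀ {n} → Graph n → Fin n → Fin n → Set
Edge G u v = adj G u v ≡ true

Σ< : ∀ n → (Fin n → ℕ) → ℕ
Σ< n f = VF.foldr _+_ 0 f

b2n : Bool → ℕ
b2n true  = 1
b2n false = 0

-- number of edges = number of pairs (u , v) with toℕ u < toℕ v and uv ∈ E(G)
ltB : ℕ → ℕ → Bool
ltB zero    zero    = false
ltB zero    (suc _) = true
ltB (suc _) zero    = false
ltB (suc m) (suc n) = ltB m n

andB : Bool → Bool → Bool
andB true b  = b
andB false _ = false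

edgeCount : ∀ {n} → Graph n → ℕ
edgeCount {n} G = Σ< n λ u → Σ< n λ v → b2n (andB (ltB (toℕ u) (toℕ v)) (adj G u v))

-- An edge-colouring: assigns a colour (a natural number) to each edge;
-- symmetric so that it is a function of the unordered edge.
record EdgeColouring {n} (G : Graph n) : Set where
  field
    col    : Fin n → Fin n → ℕ
    colSym : ∀ u v → Edge G u v → col u v ≡ col v u
open EdgeColouring public

Proper : ∀ {n} {G : Graph n} → EdgeColouring G → Set
Proper {n} {G} c = ∀ u v w → Edge G u v → Edge G u w → v ≢ w → col c u v ≢ col c u w

record MatchingCopy {n} (G : Graph n) (k : ℕ) : Set where
  field
    a b     : Fin k → Fin n
    isEdge  : ∀ i → Edge G (a i) (b i)
    aInj    : ∀ i j → a i ≡ a j → i ≡ j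
    bInj    : ∀ i j → b i ≡ b j → i ≡ j
    abDisj  : ∀ i j → a i ≢ b j
open MatchingCopy public

Rainbow : ∀ {n} {G : Graph n} {k} → EdgeColouring G → MatchingCopy G k → Set
Rainbow c M = ∀ i j → col c (a M i) (b M i) ≡ col c (a M j) (b M j) → i ≡ j

AdmitsNoRainbowMatching : ∀ {n} → Graph n → ℕ → Set
AdmitsNoRainbowMatching G k =
  Σ (EdgeColouring G) λ c → Proper c × (¬ Σ (MatchingCopy G k) (Rainbow c))

IsRainbowTuranNumberMatching : ℕ → ℕ → ℕ → Set
IsRainbowTuranNumberMatching n k m =
  (Σ (Graph n) λ G → AdmitsNoRainbowMatching G k × edgeCount G ≡ m)
  × (∀ (G : Graph n) → AdmitsNoRainbowMatching G k → edgeCount G ≤ m)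

-- Lower bound: the complete split graph with clique part of size k - 1, coloured by
-- u + v, has the required number of edges and no matching with k edges at all.
--
-- Upper bound, by induction on k, for graphs living inside a set A of at most m
-- vertices, m ≥ 14(k - 1). If some vertex x has degree ≥ 3k - 2, then G - x has no
-- rainbow M_(k-1): such a matching spans 2k - 2 vertices and k - 1 colours, and by
-- properness each colour appears at most once at x, so some edge at x would extend
-- it. Hence e(G) ≤ (m - 1) + ex*(m - 1, M_(k-1)), which is the claimed value.
-- Otherwise all degrees are < 3k - 2. Take a maximal rainbow matching M (t ≤ k - 1
-- edges): every edge meets V(M) or has a colour of M. At most 6(k - 1)t edges meet
-- V(M), and each colour class is a matching in A, so at most tm/2 edges carry a
-- colour of M. This totals at most (k - 1)(m - k + 1) edges since m ≥ 14(k - 1);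
-- so the hypothesis n ≥ 9k² is only used through n ≥ 14(k - 1).
module Submission where

open import Defs renaming (sym to adj-sym)
open import Data.Nat.Properties
open import Algebra.Properties.Semiring.Sum +-*-semiring
  using (sum-cong-≗; ∑-distrib-+; ∑-comm; *-distribˡ-sum)
open import Data.Bool using (Bool; true; false; not; _∧_; _∨_)
open import Data.Bool.Properties using (∧-identityʳ; ∨-comm)
import Data.Bool as Bool
open import Data.Empty using (⊥; ⊥-elim)
open import Data.Fin using (Fin; zero; suc; toℕ; fromℕ<; inject≤)
open import Data.Fin.Properties
  using (toℕ-injective; toℕ-fromℕ<; toℕ-inject≤; pigeonhole; any?)
  renaming (_≟_ to _≟ᶠ_; <⇒≢ to <⇒≢ᶠ; suc-injective to sucᶠ-injective)
open import Data.Nat using (ℕ; zero; suc; _+_; _*_; _∸_; _≤_; _<_; z≤n; s≤s; _≟_; _<?_)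
open import Data.Nat.Combinatorics using (_C_; nCk+nC[k+1]≡[n+1]C[k+1]; nC1≡n)
open import Data.Nat.Tactic.RingSolver using (solve-∀)
open import Data.Product using (Σ; _×_; _,_; proj₁; proj₂; ∃)
open import Data.Sum using (_⊎_; inj₁; inj₂)
open import Data.Vec.Functional using (_∷_)
open import Function using (_∘_; mk⇔)
open import Relation.Nullary using (¬_; Dec; yes; no; does; contradiction)
open import Relation.Nullary.Decidable
  using (_×-dec_; _⊎-dec_; ¬?; decidable-stable; dec-true; dec-false; does-⇔)
open import Relation.Unary using (Decidable)
open import Relation.Binary.Definitions using (tri<; tri≈; tri>)
open import Relation.Binary.PropositionalEquality

-- Finite sums and cardinalities

Σ-mono-≤ : ∀ n {f g : Fin n → ℕ} → (∀ i → f i ≤ g i) → Σ< n f ≤ Σ< n g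
Σ-mono-≤ zero    f≤g = z≤n
Σ-mono-≤ (suc n) f≤g = +-mono-≤ (f≤g zero) (Σ-mono-≤ n (f≤g ∘ suc))

Σ-const : ∀ n c → Σ< n (λ _ → c) ≡ n * c
Σ-const zero    c = refl
Σ-const (suc n) c = cong (c +_) (Σ-const n c)

Σ-*ˡ : ∀ n c (f : Fin n → ℕ) → Σ< n (λ i → c * f i) ≡ c * Σ< n f
Σ-*ˡ n c f = sym (*-distribˡ-sum c f)

term≤Σ : ∀ n (f : Fin n → ℕ) i → f i ≤ Σ< n f
term≤Σ (suc n) f zero    = m≤m+n (f zero) _
term≤Σ (suc n) f (suc i) = ≤-trans (term≤Σ n (f ∘ suc) i) (m≤n+m _ (f zero))

b2n-≤ : ∀ {b m} → (b ≡ true → 1 ≤ m) → b2n b ≤ m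
b2n-≤ {true}  h = h refl
b2n-≤ {false} h = z≤n

∧-trueˡ : ∀ a {b} → a ∧ b ≡ true → a ≡ true
∧-trueˡ true _ = refl

∧-trueʳ : ∀ a {b} → a ∧ b ≡ true → b ≡ true
∧-trueʳ true e = e

andB-trueʳ : ∀ a {b} → andB a b ≡ true → b ≡ true
andB-trueʳ true e = e

does-true : ∀ {p} {P : Set p} (P? : Dec P) → does P? ≡ true → P
does-true (yes p) _ = p

card : ∀ {n} → (Fin n → Bool) → ℕ
card {n} P = Σ< n (b2n ∘ P)

card-mono : ∀ {n} {P Q : Fin n → Bool} → (∀ u → P u ≡ true → Q u ≡ true) → card P ≤ card Q
card-mono {n} {P} P⊆Q = Σ-mono-≤ n λ u → b2n-≤ λ Pu → ≤-reflexive (cong b2n (sym (P⊆Q u Pu)))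

card-empty : ∀ {n} {P : Fin n → Bool} → (∀ u → P u ≡ false) → card P ≡ 0
card-empty {n} {P} none = trans (sum-cong-≗ (cong b2n ∘ none)) (trans (Σ-const n 0) (*-zeroʳ n))

card-≤1 : ∀ {n} {P : Fin n → Bool} →
  (∀ u v → P u ≡ true → P v ≡ true → u ≡ v) → card P ≤ 1
card-≤1 {zero}      unique = z≤n
card-≤1 {suc n} {P} unique with P zero in P0
... | false = card-≤1 λ u v Pu Pv → sucᶠ-injective (unique (suc u) (suc v) Pu Pv)
... | true  = ≤-reflexive (cong suc (card-empty only-zero))
  where
  only-zero : ∀ u → P (suc u) ≡ false
  only-zero u with P (suc u) in Pu
  ... | false = refl
  ... | true  = contradiction (unique zero (suc u) P0 Pu) λ ()

｛_｝ : ∀ {n} → Fin n → Fin n → Bool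
｛ x ｝ u = does (u ≟ᶠ x)

δ : ∀ {n} → Fin n → Fin n → ℕ
δ u x = b2n (｛ x ｝ u)

Σ-δ : ∀ n (x : Fin n) (g : Fin n → ℕ) → Σ< n (λ u → δ u x * g u) ≡ g x
Σ-δ (suc n) zero    g = begin
  g zero + 0 + Σ< n (λ _ → 0)  ≡⟨ cong (g zero + 0 +_) (trans (Σ-const n 0) (*-zeroʳ n)) ⟩
  g zero + 0 + 0               ≡⟨ trans (+-identityʳ _) (+-identityʳ _) ⟩
  g zero                       ∎
  where open ≡-Reasoning
Σ-δ (suc n) (suc x) g = Σ-δ n x (g ∘ suc)

card-｛｝ : ∀ {n} (x : Fin n) → card ｛ x ｝ ≡ 1
card-｛｝ {n} x = trans (sum-cong-≗ λ u → sym (*-identityʳ (δ u x))) (Σ-δ n x (λ _ → 1))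

_−_ : ∀ {n} → (Fin n → Bool) → (Fin n → Bool) → Fin n → Bool
(A − W) u = A u ∧ not (W u)

card-remove : ∀ {n} (A : Fin n → Bool) {x} → A x ≡ true → card A ≡ suc (card (A − ｛ x ｝))
card-remove {n} A {x} Ax = begin
  card A
    ≡⟨ sum-cong-≗ split ⟩
  Σ< n (λ u → b2n ((A − ｛ x ｝) u) + δ u x)
    ≡⟨ ∑-distrib-+ (b2n ∘ (A − ｛ x ｝)) (λ u → δ u x) ⟩
  card (A − ｛ x ｝) + card ｛ x ｝
    ≡⟨ trans (cong (card (A − ｛ x ｝) +_) (card-｛｝ x)) (+-comm _ 1) ⟩
  suc (card (A − ｛ x ｝)) ∎
  where
  open ≡-Reasoning
  split : ∀ u → b2n (A u) ≡ b2n ((A − ｛ x ｝) u) + δ u x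
  split u with u ≟ᶠ x
  ... | yes refl rewrite Ax = refl
  ... | no  _    rewrite ∧-identityʳ (A u) = sym (+-identityʳ _)

-- Graphs and edge counts

_⊆_ : ∀ {n} → Graph n → Graph n → Set
G ⊆ H = ∀ {u v} → Edge G u v → Edge H u v

Supported : ∀ {n} → Graph n → (Fin n → Bool) → Set
Supported G A = ∀ {u v} → Edge G u v → A u ≡ true

Edge? : ∀ {n} (G : Graph n) u v → Dec (Edge G u v)
Edge? G u v = adj G u v Bool.≟ true

edge-sym : ∀ {n} (G : Graph n) {u v} → Edge G u v → Edge G v u
edge-sym G {u} {v} e = trans (adj-sym G v u) e

edge-irrefl : ∀ {n} (G : Graph n) {u v} → Edge G u v → u ≢ v
edge-irrefl G {u} e refl = contradiction (trans (sym (irref G u)) e) λ ()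

deg : ∀ {n} → Graph n → Fin n → ℕ
deg G x = card (adj G x)

deg-outside : ∀ {n} (G : Graph n) {A} → Supported G A → ∀ {u} → A u ≡ false → deg G u ≡ 0
deg-outside G sup {u} Au = card-empty isolated
  where
  isolated : ∀ v → adj G u v ≡ false
  isolated v with adj G u v in e
  ... | false = refl
  ... | true  = contradiction (trans (sym (sup e)) Au) λ ()

deg-≤-card : ∀ {n} (G : Graph n) {A} → Supported G A → ∀ x → deg G x ≤ card (A − ｛ x ｝)
deg-≤-card G {A} sup x = card-mono neighbour
  where
  neighbour : ∀ v → adj G x v ≡ true → (A − ｛ x ｝) v ≡ true
  neighbour v e rewrite sup (edge-sym G e) | dec-false (v ≟ᶠ x) (edge-irrefl G e ∘ sym) = refl

_∖_ : ∀ {n} → Graph n → (Fin n → Bool) → Graph n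
G ∖ W = record
  { adj   = λ u v → adj G u v ∧ not (W u ∨ W v)
  ; sym   = λ u v → cong₂ _∧_ (adj-sym G u v) (cong not (∨-comm (W u) (W v)))
  ; irref = λ u → cong (_∧ _) (irref G u)
  }

∖-⊆ : ∀ {n} (G : Graph n) W → (G ∖ W) ⊆ G
∖-⊆ G W {u} {v} = ∧-trueˡ (adj G u v)

∖-avoids : ∀ {n} (G : Graph n) W {u v} → Edge (G ∖ W) u v → W u ≡ false
∖-avoids G W {u} {v} e with W u | ∧-trueʳ (adj G u v) e
... | false | _ = refl
... | true  | ()

∖-supported : ∀ {n} (G : Graph n) {A} → Supported G A → ∀ W → Supported (G ∖ W) (A − W)
∖-supported G sup W e = cong₂ _∧_ (sup (∖-⊆ G W e)) (cong not (∖-avoids G W e))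

ltB-< : ∀ {a b} → a < b → ltB a b ≡ true
ltB-< {zero}  (s≤s _)   = refl
ltB-< {suc a} (s≤s a<b) = ltB-< a<b

ltB-≥ : ∀ {a b} → b ≤ a → ltB a b ≡ false
ltB-≥ {zero}  z≤n       = refl
ltB-≥ {suc a} z≤n       = refl
ltB-≥ {suc a} (s≤s b≤a) = ltB-≥ b≤a

ltB-sound : ∀ {a b} → ltB a b ≡ true → a < b
ltB-sound {zero}  {suc b} _ = s≤s z≤n
ltB-sound {suc a} {suc b} e = s≤s (ltB-sound e)

forwardEdge : ∀ {n} → Graph n → Fin n → Fin n → ℕ
forwardEdge G u v = b2n (andB (ltB (toℕ u) (toℕ v)) (adj G u v))

forwardEdge-split : ∀ {n} (G : Graph n) u v → forwardEdge G u v + forwardEdge G v u ≡ b2n (adj G u v)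
forwardEdge-split G u v with <-cmp (toℕ u) (toℕ v)
... | tri< u<v _ _ rewrite ltB-< u<v | ltB-≥ (<⇒≤ u<v) = +-identityʳ _
... | tri≈ _ u≡v _ rewrite toℕ-injective u≡v | ltB-≥ (≤-refl {toℕ v}) | irref G v = refl
... | tri> _ _ v<u rewrite ltB-≥ (<⇒≤ v<u) | ltB-< v<u | adj-sym G v u = refl

forwardEdge-on-edges : ∀ {n} (G : Graph n) {u v m} →
  (Edge G u v → forwardEdge G u v ≤ m) → forwardEdge G u v ≤ m
forwardEdge-on-edges G h = b2n-≤ λ e → ≤-trans (≤-reflexive (cong b2n (sym e))) (h (andB-trueʳ _ e))

forwardEdge-mono : ∀ {n} (G H : Graph n) u v →
  (Edge G u v → Edge H u v) → forwardEdge G u v ≤ forwardEdge H u v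
forwardEdge-mono G H u v G⇒H = forwardEdge-on-edges G λ e →
  ≤-reflexive (cong (b2n ∘ andB (ltB (toℕ u) (toℕ v))) (trans e (sym (G⇒H e))))

weighted-handshake : ∀ {n} (G : Graph n) (ω : Fin n → ℕ) →
  Σ< n (λ u → Σ< n (λ v → (ω u + ω v) * forwardEdge G u v)) ≡ Σ< n (λ w → ω w * deg G w)
weighted-handshake {n} G ω = begin
  Σ< n (λ u → Σ< n (λ v → (ω u + ω v) * f u v))
    ≡⟨ sum-cong-≗ (λ u → trans (sum-cong-≗ λ v → *-distribʳ-+ (f u v) (ω u) (ω v))
                               (∑-distrib-+ (λ v → ω u * f u v) _)) ⟩
  Σ< n (λ u → Σ< n (λ v → ω u * f u v) + Σ< n (λ v → ω v * f u v))
    ≡⟨ ∑-distrib-+ (λ u → Σ< n (λ v → ω u * f u v)) _ ⟩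
  Σ< n (λ u → Σ< n (λ v → ω u * f u v)) + Σ< n (λ u → Σ< n (λ v → ω v * f u v))
    ≡⟨ cong₂ _+_ (sum-cong-≗ λ u → Σ-*ˡ n (ω u) (f u))
                 (trans (∑-comm (λ u v → ω v * f u v))
                        (sum-cong-≗ λ v → Σ-*ˡ n (ω v) (λ u → f u v))) ⟩
  Σ< n (λ w → ω w * Σ< n (f w)) + Σ< n (λ w → ω w * Σ< n (λ u → f u w))
    ≡⟨ ∑-distrib-+ (λ w → ω w * Σ< n (f w)) _ ⟨
  Σ< n (λ w → ω w * Σ< n (f w) + ω w * Σ< n (λ u → f u w))
    ≡⟨ sum-cong-≗ (λ w → trans (sym (*-distribˡ-+ (ω w) _ _)) (cong (ω w *_) (incident w))) ⟩
  Σ< n (λ w → ω w * deg G w) ∎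
  where
  open ≡-Reasoning
  f : Fin n → Fin n → ℕ
  f = forwardEdge G
  incident : ∀ w → Σ< n (f w) + Σ< n (λ u → f u w) ≡ deg G w
  incident w = trans (sym (∑-distrib-+ (f w) (λ u → f u w))) (sum-cong-≗ (forwardEdge-split G w))

handshake : ∀ {n} (G : Graph n) → Σ< n (deg G) ≡ 2 * edgeCount G
handshake {n} G = begin
  Σ< n (deg G)
    ≡⟨ sum-cong-≗ (λ w → sym (*-identityˡ (deg G w))) ⟩
  Σ< n (λ w → 1 * deg G w)
    ≡⟨ weighted-handshake G (λ _ → 1) ⟨
  Σ< n (λ u → Σ< n (λ v → 2 * forwardEdge G u v))
    ≡⟨ sum-cong-≗ (λ u → Σ-*ˡ n 2 (forwardEdge G u)) ⟩
  Σ< n (λ u → 2 * Σ< n (forwardEdge G u))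
    ≡⟨ Σ-*ˡ n 2 _ ⟩
  2 * edgeCount G ∎
  where open ≡-Reasoning

edgeCount-≤-∖ : ∀ {n} (G : Graph n) (W : Fin n → Bool) →
  edgeCount G ≤ Σ< n (λ w → b2n (W w) * deg G w) + edgeCount (G ∖ W)
edgeCount-≤-∖ {n} G W = begin
  edgeCount G
    ≤⟨ Σ-mono-≤ n (λ u → Σ-mono-≤ n (split u)) ⟩
  Σ< n (λ u → Σ< n (λ v → (ω u + ω v) * forwardEdge G u v + forwardEdge (G ∖ W) u v))
    ≡⟨ sum-cong-≗ (λ u → ∑-distrib-+ (λ v → (ω u + ω v) * forwardEdge G u v) _) ⟩
  Σ< n (λ u → Σ< n (λ v → (ω u + ω v) * forwardEdge G u v) + Σ< n (forwardEdge (G ∖ W) u))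
    ≡⟨ ∑-distrib-+ (λ u → Σ< n (λ v → (ω u + ω v) * forwardEdge G u v)) _ ⟩
  Σ< n (λ u → Σ< n (λ v → (ω u + ω v) * forwardEdge G u v)) + edgeCount (G ∖ W)
    ≡⟨ cong (_+ edgeCount (G ∖ W)) (weighted-handshake G ω) ⟩
  Σ< n (λ w → ω w * deg G w) + edgeCount (G ∖ W) ∎
  where
  open ≤-Reasoning
  ω : Fin n → ℕ
  ω = b2n ∘ W
  split : ∀ u v → forwardEdge G u v ≤ (ω u + ω v) * forwardEdge G u v + forwardEdge (G ∖ W) u v
  split u v with W u | W v
  ... | true  | _     = ≤-trans (m≤m+n _ _) (m≤m+n _ _)
  ... | false | true  = ≤-trans (m≤m+n _ 0) (m≤m+n _ _)
  ... | false | false =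
    ≤-reflexive (cong (b2n ∘ andB (ltB (toℕ u) (toℕ v))) (sym (∧-identityʳ (adj G u v))))

edgeCount-≤-deg+∖ : ∀ {n} (G : Graph n) x → edgeCount G ≤ deg G x + edgeCount (G ∖ ｛ x ｝)
edgeCount-≤-deg+∖ {n} G x =
  ≤-trans (edgeCount-≤-∖ G ｛ x ｝)
          (≤-reflexive (cong (_+ edgeCount (G ∖ ｛ x ｝)) (Σ-δ n x (deg G))))

edgeCount-≤-Σ : ∀ {n t} (H : Graph n) (G : Fin t → Graph n) →
  (∀ {u v} → Edge H u v → ∃ λ i → Edge (G i) u v) →
  edgeCount H ≤ Σ< t (λ i → edgeCount (G i))
edgeCount-≤-Σ {n} {t} H G covered = begin
  edgeCount H
    ≤⟨ Σ-mono-≤ n (λ u → Σ-mono-≤ n (pointwise u)) ⟩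
  Σ< n (λ u → Σ< n (λ v → Σ< t (λ i → forwardEdge (G i) u v)))
    ≡⟨ sum-cong-≗ (λ u → ∑-comm (λ v i → forwardEdge (G i) u v)) ⟩
  Σ< n (λ u → Σ< t (λ i → Σ< n (forwardEdge (G i) u)))
    ≡⟨ ∑-comm (λ u i → Σ< n (forwardEdge (G i) u)) ⟩
  Σ< t (λ i → edgeCount (G i)) ∎
  where
  open ≤-Reasoning
  pointwise : ∀ u v → forwardEdge H u v ≤ Σ< t (λ i → forwardEdge (G i) u v)
  pointwise u v = forwardEdge-on-edges H λ e → let (i , e′) = covered e in
    ≤-trans (forwardEdge-mono H (G i) u v (λ _ → e′)) (term≤Σ t (λ i → forwardEdge (G i) u v) i)

-- Colour classes and rainbow matchings

restrict : ∀ {n} {G : Graph n} (H : Graph n) → H ⊆ G → EdgeColouring G → EdgeColouring H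
restrict H H⊆G c = record { col = col c ; colSym = λ u v e → colSym c u v (H⊆G e) }

restrict-proper : ∀ {n} {G : Graph n} (H : Graph n) (H⊆G : H ⊆ G) {c : EdgeColouring G} →
  Proper c → Proper (restrict H H⊆G c)
restrict-proper H H⊆G proper u v w e₁ e₂ = proper u v w (H⊆G e₁) (H⊆G e₂)

colourClass : ∀ {n} {G : Graph n} → EdgeColouring G → ℕ → Graph n
colourClass {G = G} c γ = record
  { adj   = λ u v → adj G u v ∧ does (col c u v ≟ γ)
  ; sym   = symmetric
  ; irref = λ u → cong (_∧ _) (irref G u)
  }
  where
  symmetric : ∀ u v → adj G u v ∧ does (col c u v ≟ γ) ≡ adj G v u ∧ does (col c v u ≟ γ)
  symmetric u v with adj G u v in e
  ... | true  rewrite adj-sym G v u | e | colSym c u v e = refl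
  ... | false rewrite adj-sym G v u | e = refl

colourClass-edge : ∀ {n} {G : Graph n} (c : EdgeColouring G) {γ u v} →
  Edge G u v → col c u v ≡ γ → Edge (colourClass c γ) u v
colourClass-edge c {γ} {u} {v} e refl = cong₂ _∧_ e (dec-true (col c u v ≟ γ) refl)

colourClass-⊆ : ∀ {n} {G : Graph n} (c : EdgeColouring G) γ → colourClass c γ ⊆ G
colourClass-⊆ {G = G} c γ {u} {v} = ∧-trueˡ (adj G u v) {does (col c u v ≟ γ)}

colourClass-col : ∀ {n} {G : Graph n} (c : EdgeColouring G) γ {u v} →
  Edge (colourClass c γ) u v → col c u v ≡ γ
colourClass-col {G = G} c γ {u} {v} e = does-true (col c u v ≟ γ) (∧-trueʳ (adj G u v) e)

deg-colourClass-≤1 : ∀ {n} {G : Graph n} (c : EdgeColouring G) → Proper c →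
  ∀ γ x → deg (colourClass c γ) x ≤ 1
deg-colourClass-≤1 c proper γ x = card-≤1 λ v w e₁ e₂ → decidable-stable (v ≟ᶠ w) λ v≢w →
  proper x v w (colourClass-⊆ c γ e₁) (colourClass-⊆ c γ e₂) v≢w
    (trans (colourClass-col c γ e₁) (sym (colourClass-col c γ e₂)))

2*edgeCount-colourClass≤card : ∀ {n} {G : Graph n} (c : EdgeColouring G) {A} →
  Proper c → Supported G A → ∀ γ → 2 * edgeCount (colourClass c γ) ≤ card A
2*edgeCount-colourClass≤card {n} c {A} proper sup γ = begin
  2 * edgeCount (colourClass c γ)   ≡⟨ handshake (colourClass c γ) ⟨
  Σ< n (deg (colourClass c γ))     ≤⟨ Σ-mono-≤ n deg≤ ⟩
  card A                           ∎
  where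
  open ≤-Reasoning
  deg≤ : ∀ u → deg (colourClass c γ) u ≤ b2n (A u)
  deg≤ u with A u in Au
  ... | true  = deg-colourClass-≤1 c proper γ u
  ... | false = ≤-reflexive (deg-outside (colourClass c γ) (λ e → sup (colourClass-⊆ c γ e)) Au)

module _ {n} {G : Graph n} where

  Covers : ∀ {t} → MatchingCopy G t → Fin n → Set
  Covers {t} M w = ∃ λ (i : Fin t) → w ≡ a M i ⊎ w ≡ b M i

  covers? : ∀ {t} (M : MatchingCopy G t) → Decidable (Covers M)
  covers? M w = any? λ i → (w ≟ᶠ a M i) ⊎-dec (w ≟ᶠ b M i)

  covered : ∀ {t} → MatchingCopy G t → Fin n → Bool
  covered M w = does (covers? M w)

  uncovered : ∀ {t} (M : MatchingCopy G t) {w} → covered M w ≡ false → ¬ Covers M w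
  uncovered M {w} h with covers? M w
  ... | no ∉M = ∉M
  ... | yes _ = contradiction h λ ()

  card-covered : ∀ {t} (M : MatchingCopy G t) → card (covered M) ≤ 2 * t
  card-covered {t} M = begin
    card (covered M)                                     ≤⟨ Σ-mono-≤ n covered≤ ⟩
    Σ< n (λ w → Σ< t (λ i → δ w (a M i) + δ w (b M i)))  ≡⟨ ∑-comm (λ w i → δ w (a M i) + δ w (b M i)) ⟩
    Σ< t (λ i → Σ< n (λ w → δ w (a M i) + δ w (b M i)))  ≡⟨ sum-cong-≗ endpoints ⟩
    Σ< t (λ _ → 2)                                       ≡⟨ trans (Σ-const t 2) (*-comm t 2) ⟩
    2 * t                                                ∎
    where
    open ≤-Reasoning
    δ-self : ∀ x → 1 ≤ δ x x
    δ-self x = ≤-reflexive (cong b2n (sym (dec-true (x ≟ᶠ x) refl)))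
    covered≤ : ∀ w → b2n (covered M w) ≤ Σ< t (λ i → δ w (a M i) + δ w (b M i))
    covered≤ w with covers? M w
    ... | no  _             = z≤n
    ... | yes (i , inj₁ refl) = ≤-trans (≤-trans (δ-self w) (m≤m+n _ _)) (term≤Σ t _ i)
    ... | yes (i , inj₂ refl) = ≤-trans (≤-trans (δ-self w) (m≤n+m _ _)) (term≤Σ t _ i)
    endpoints : ∀ i → Σ< n (λ w → δ w (a M i) + δ w (b M i)) ≡ 2
    endpoints i = trans (∑-distrib-+ (λ w → δ w (a M i)) _)
                        (cong₂ _+_ (card-｛｝ (a M i)) (card-｛｝ (b M i)))

  UsesColour : ∀ {t} → EdgeColouring G → MatchingCopy G t → ℕ → Set
  UsesColour c M γ = ∃ λ i → col c (a M i) (b M i) ≡ γ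

  usesColour? : ∀ {t} (c : EdgeColouring G) (M : MatchingCopy G t) → Decidable (UsesColour c M)
  usesColour? c M γ = any? λ i → col c (a M i) (b M i) ≟ γ

  emptyMatching : MatchingCopy G 0
  emptyMatching = record
    { a = λ () ; b = λ () ; isEdge = λ () ; aInj = λ () ; bInj = λ () ; abDisj = λ () }

  ∷-injective : ∀ {t} {x} {f : Fin t → Fin n} →
    (∀ i j → f i ≡ f j → i ≡ j) → (∀ i → x ≢ f i) → ∀ i j → (x ∷ f) i ≡ (x ∷ f) j → i ≡ j
  ∷-injective f-inj x∉ zero    zero    _ = refl
  ∷-injective f-inj x∉ zero    (suc j) p = ⊥-elim (x∉ j p)
  ∷-injective f-inj x∉ (suc i) zero    p = ⊥-elim (x∉ i (sym p))
  ∷-injective f-inj x∉ (suc i) (suc j) p = cong suc (f-inj i j p)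

  extend : ∀ {t} (M : MatchingCopy G t) {x y} →
    Edge G x y → ¬ Covers M x → ¬ Covers M y → MatchingCopy G (suc t)
  extend M {x} {y} e x∉ y∉ = record
    { a      = x ∷ a M
    ; b      = y ∷ b M
    ; isEdge = λ { zero → e ; (suc i) → isEdge M i }
    ; aInj   = ∷-injective (aInj M) λ i p → x∉ (i , inj₁ p)
    ; bInj   = ∷-injective (bInj M) λ i p → y∉ (i , inj₂ p)
    ; abDisj = disjoint
    }
    where
    disjoint : ∀ i j → (x ∷ a M) i ≢ (y ∷ b M) j
    disjoint zero    zero    = edge-irrefl G e
    disjoint zero    (suc j) = λ p → x∉ (j , inj₂ p)
    disjoint (suc i) zero    = λ p → y∉ (i , inj₁ (sym p))
    disjoint (suc i) (suc j) = abDisj M i j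

  extend-rainbow : ∀ {t} (c : EdgeColouring G) (M : MatchingCopy G t) {x y} (e : Edge G x y)
    (x∉ : ¬ Covers M x) (y∉ : ¬ Covers M y) → Rainbow c M → ¬ UsesColour c M (col c x y) →
    Rainbow c (extend M e x∉ y∉)
  extend-rainbow c M e x∉ y∉ rainbow new zero    zero    _ = refl
  extend-rainbow c M e x∉ y∉ rainbow new zero    (suc j) p = ⊥-elim (new (j , sym p))
  extend-rainbow c M e x∉ y∉ rainbow new (suc i) zero    p = ⊥-elim (new (i , p))
  extend-rainbow c M e x∉ y∉ rainbow new (suc i) (suc j) p = cong suc (rainbow i j p)

  Maximal : ∀ {t} → EdgeColouring G → MatchingCopy G t → Set
  Maximal c M = ∀ {u v} → Edge G u v → ¬ Covers M u → ¬ Covers M v → UsesColour c M (col c u v)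

  extend-or-maximal : ∀ {t} (c : EdgeColouring G) (M : MatchingCopy G t) → Rainbow c M →
    Σ (MatchingCopy G (suc t)) (Rainbow c) ⊎ Maximal c M
  extend-or-maximal c M rainbow with any? (λ u → any? (λ v →
    Edge? G u v ×-dec ¬? (covers? M u) ×-dec ¬? (covers? M v) ×-dec ¬? (usesColour? c M (col c u v))))
  ... | yes (u , v , e , u∉ , v∉ , new) =
    inj₁ (extend M e u∉ v∉ , extend-rainbow c M e u∉ v∉ rainbow new)
  ... | no  stuck = inj₂ λ {u} {v} e u∉ v∉ →
    decidable-stable (usesColour? c M (col c u v)) λ new → stuck (u , v , e , u∉ , v∉ , new)

  record MaximalRainbowMatching (c : EdgeColouring G) (j : ℕ) : Set where
    field
      size     : ℕ
      size≤    : size ≤ j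
      matching : MatchingCopy G size
      rainbow  : Rainbow c matching
      maximal  : Maximal c matching

  maximalRainbowMatching : ∀ (c : EdgeColouring G) j → ¬ Σ (MatchingCopy G (suc j)) (Rainbow c) →
    MaximalRainbowMatching c j
  maximalRainbowMatching c j none = grow (suc j) 0 (+-identityʳ (suc j)) emptyMatching λ ()
    where
    grow : ∀ r t → r + t ≡ suc j → (M : MatchingCopy G t) → Rainbow c M → MaximalRainbowMatching c j
    grow zero    t refl M rainbow = ⊥-elim (none (M , rainbow))
    grow (suc r) t r+t M rainbow with extend-or-maximal c M rainbow
    ... | inj₁ (M′ , rainbow′) = grow r (suc t) (trans (+-suc r t) r+t) M′ rainbow′
    ... | inj₂ maximal = record
      { size = t ; size≤ = subst (t ≤_) (suc-injective r+t) (m≤n+m t r)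
      ; matching = M ; rainbow = rainbow ; maximal = maximal }

  mapMatching : ∀ {H : Graph n} {t} → H ⊆ G → MatchingCopy H t → MatchingCopy G t
  mapMatching H⊆G M = record
    { a = a M ; b = b M ; isEdge = λ i → H⊆G (isEdge M i)
    ; aInj = aInj M ; bInj = bInj M ; abDisj = abDisj M }

  deg-≤-3t : ∀ {t} (c : EdgeColouring G) → Proper c → (M : MatchingCopy G t) → ∀ {x} →
    (∀ {y} → Edge G x y → ¬ Covers M y → UsesColour c M (col c x y)) → deg G x ≤ 3 * t
  deg-≤-3t {t} c proper M {x} saturated = begin
    deg G x
      ≤⟨ Σ-mono-≤ n split ⟩
    Σ< n (λ y → b2n (covered M y) + Σ< t (λ i → b2n (adj (class i) x y)))
      ≡⟨ ∑-distrib-+ (b2n ∘ covered M) _ ⟩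
    card (covered M) + Σ< n (λ y → Σ< t (λ i → b2n (adj (class i) x y)))
      ≡⟨ cong (card (covered M) +_) (∑-comm (λ y i → b2n (adj (class i) x y))) ⟩
    card (covered M) + Σ< t (λ i → deg (class i) x)
      ≤⟨ +-mono-≤ (card-covered M) (Σ-mono-≤ t λ i → deg-colourClass-≤1 c proper _ x) ⟩
    2 * t + Σ< t (λ _ → 1)
      ≡⟨ cong (2 * t +_) (trans (Σ-const t 1) (*-identityʳ t)) ⟩
    2 * t + t
      ≡⟨ +-comm (2 * t) t ⟩
    3 * t ∎
    where
    open ≤-Reasoning
    class : Fin t → Graph n
    class i = colourClass c (col c (a M i) (b M i))
    split : ∀ y → b2n (adj G x y) ≤ b2n (covered M y) + Σ< t (λ i → b2n (adj (class i) x y))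
    split y = b2n-≤ λ e → by-cases (covers? M y) e
      where
      by-cases : (y? : Dec (Covers M y)) → Edge G x y →
        1 ≤ b2n (does y?) + Σ< t (λ i → b2n (adj (class i) x y))
      by-cases (yes _)  e = s≤s z≤n
      by-cases (no y∉M) e with saturated e y∉M
      ... | i , same = ≤-trans (≤-reflexive (cong b2n (sym (colourClass-edge c e (sym same)))))
                                (≤-trans (term≤Σ t (λ i → b2n (adj (class i) x y)) i) (m≤n+m _ 0))

  extend-at-high-degree : ∀ {t} (c : EdgeColouring G) → Proper c →
    (M : MatchingCopy G t) → Rainbow c M → ∀ {x} → ¬ Covers M x → 3 * t < deg G x →
    Σ (MatchingCopy G (suc t)) (Rainbow c)
  extend-at-high-degree c proper M rainbow {x} x∉ high
    with any? (λ y → Edge? G x y ×-dec ¬? (covers? M y) ×-dec ¬? (usesColour? c M (col c x y)))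
  ... | yes (y , e , y∉ , new) = extend M e x∉ y∉ , extend-rainbow c M e x∉ y∉ rainbow new
  ... | no stuck = ⊥-elim (<⇒≱ high (deg-≤-3t c proper M λ {y} e y∉ →
    decidable-stable (usesColour? c M (col c x y)) λ new → stuck (y , e , y∉ , new)))

∖-avoids-matching : ∀ {n} (G : Graph n) W {t} (M : MatchingCopy (G ∖ W) t) {w} →
  W w ≡ true → ¬ Covers M w
∖-avoids-matching G W M Ww (i , inj₁ refl) =
  contradiction (trans (sym Ww) (∖-avoids G W (isEdge M i))) λ ()
∖-avoids-matching G W M Ww (i , inj₂ refl) =
  contradiction (trans (sym Ww) (∖-avoids G W (edge-sym (G ∖ W) (isEdge M i)))) λ ()

edgeCount-≤-maximal : ∀ {n} {G : Graph n} (c : EdgeColouring G) {t} (M : MatchingCopy G t) →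
  Maximal c M →
  edgeCount G ≤ Σ< n (λ w → b2n (covered M w) * deg G w)
               + Σ< t (λ i → edgeCount (colourClass c (col c (a M i) (b M i))))
edgeCount-≤-maximal {n} {G} c {t} M maximal =
  ≤-trans (edgeCount-≤-∖ G (covered M))
          (+-monoʳ-≤ _ (edgeCount-≤-Σ (G ∖ covered M) class colouredByM))
  where
  class : Fin t → Graph n
  class i = colourClass c (col c (a M i) (b M i))
  colouredByM : ∀ {u v} → Edge (G ∖ covered M) u v → ∃ λ i → Edge (class i) u v
  colouredByM e with maximal (∖-⊆ G (covered M) e) (uncovered M (∖-avoids G (covered M) e))
                             (uncovered M (∖-avoids G (covered M) (edge-sym (G ∖ covered M) e)))
  ... | i , same = i , colourClass-edge c (∖-⊆ G (covered M) e) (sym same)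

-- Arithmetic

suc-C2 : ∀ j → suc j C 2 ≡ j + j C 2
suc-C2 j = trans (sym (nCk+nC[k+1]≡[n+1]C[k+1] j 1)) (cong (_+ j C 2) (nC1≡n j))

C2-step : ∀ j m → suc j ≤ m →
  (m ∸ 1) + (j C 2 + j * (m ∸ 1 ∸ j)) ≡ suc j C 2 + suc j * (m ∸ suc j)
C2-step j (suc m) (s≤s j≤m) = begin
  m + (j C 2 + j * (m ∸ j))              ≡⟨ cong (_+ (j C 2 + j * (m ∸ j))) (m+[n∸m]≡n j≤m) ⟨
  (j + (m ∸ j)) + (j C 2 + j * (m ∸ j))  ≡⟨ regroup j (j C 2) (m ∸ j) ⟩
  (j + j C 2) + suc j * (m ∸ j)          ≡⟨ cong (_+ suc j * (m ∸ j)) (suc-C2 j) ⟨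
  suc j C 2 + suc j * (m ∸ j)            ∎
  where
  open ≡-Reasoning
  regroup : ∀ j c d → (j + d) + (c + j * d) ≡ (j + c) + suc j * d
  regroup = solve-∀

bounded-degree-arith : ∀ j m → 14 * j ≤ m → 2 * (3 * j * (2 * j)) + j * m ≤ 2 * (j * (m ∸ j))
bounded-degree-arith j m 14j≤m = begin
  2 * (3 * j * (2 * j)) + j * m
    ≡⟨ cong (λ m → 2 * (3 * j * (2 * j)) + j * m) m≡ ⟨
  2 * (3 * j * (2 * j)) + j * (j + (13 * j + d))
    ≤⟨ m≤m+n _ (j * d) ⟩
  2 * (3 * j * (2 * j)) + j * (j + (13 * j + d)) + j * d
    ≡⟨ expand j d ⟩
  2 * (j * (13 * j + d))
    ≡⟨ cong (λ k → 2 * (j * k)) (m+n∸m≡n j (13 * j + d)) ⟨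
  2 * (j * (j + (13 * j + d) ∸ j))
    ≡⟨ cong (λ m → 2 * (j * (m ∸ j))) m≡ ⟩
  2 * (j * (m ∸ j)) ∎
  where
  open ≤-Reasoning
  regroup : ∀ j d → j + (13 * j + d) ≡ 14 * j + d
  regroup = solve-∀
  d : ℕ
  d = m ∸ 14 * j
  m≡ : j + (13 * j + d) ≡ m
  m≡ = trans (regroup j d) (m+[n∸m]≡n 14j≤m)
  expand : ∀ j d → 2 * (3 * j * (2 * j)) + j * (j + (13 * j + d)) + j * d ≡ 2 * (j * (13 * j + d))
  expand = solve-∀

threshold : ∀ j → 14 * j ≤ 9 * (suc j * suc j)
threshold j = ≤-trans (m≤m+n (14 * j) (9 * (j * j) + 4 * j + 9)) (≤-reflexive (expand j))
  where
  expand : ∀ j → 14 * j + (9 * (j * j) + 4 * j + 9) ≡ 9 * (suc j * suc j)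
  expand = solve-∀

∸-suc+1 : ∀ {n j} → suc j ≤ n → n ∸ suc j + 1 ≡ n ∸ j
∸-suc+1 {suc n} {zero}  _         = +-comm n 1
∸-suc+1 {suc n} {suc j} (s≤s j<n) = ∸-suc+1 j<n

-- The upper bound

bounded-degree-bound : ∀ j {n} (G : Graph n) (c : EdgeColouring G) → Proper c →
  ∀ {A} → Supported G A → ∀ m → card A ≤ m → 14 * j ≤ m → (∀ x → deg G x ≤ 3 * j) →
  ¬ Σ (MatchingCopy G (suc j)) (Rainbow c) → edgeCount G ≤ j * (m ∸ j)
bounded-degree-bound j {n} G c proper sup m card≤m 14j≤m low none = *-cancelˡ-≤ 2 (begin
  2 * edgeCount G                        ≤⟨ *-monoʳ-≤ 2 (edgeCount-≤-maximal c matching maximal) ⟩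
  2 * (S + T)                            ≡⟨ *-distribˡ-+ 2 S T ⟩
  2 * S + 2 * T                          ≤⟨ +-mono-≤ (*-monoʳ-≤ 2 S≤) 2T≤ ⟩
  2 * (3 * j * (2 * size)) + size * m    ≤⟨ +-mono-≤ (*-monoʳ-≤ 2 (*-monoʳ-≤ (3 * j) (*-monoʳ-≤ 2 size≤)))
                                                     (*-monoˡ-≤ m size≤) ⟩
  2 * (3 * j * (2 * j)) + j * m          ≤⟨ bounded-degree-arith j m 14j≤m ⟩
  2 * (j * (m ∸ j))                      ∎)
  where
  open ≤-Reasoning
  open MaximalRainbowMatching (maximalRainbowMatching c j none)
  class : Fin size → Graph n
  class i = colourClass c (col c (a matching i) (b matching i))
  S T : ℕ
  S = Σ< n (λ w → b2n (covered matching w) * deg G w)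
  T = Σ< size (λ i → edgeCount (class i))
  S≤ : S ≤ 3 * j * (2 * size)
  S≤ = begin
    S
      ≤⟨ Σ-mono-≤ n (λ w → *-monoʳ-≤ (b2n (covered matching w)) (low w)) ⟩
    Σ< n (λ w → b2n (covered matching w) * (3 * j))
      ≡⟨ sum-cong-≗ (λ w → *-comm (b2n (covered matching w)) (3 * j)) ⟩
    Σ< n (λ w → 3 * j * b2n (covered matching w))
      ≡⟨ Σ-*ˡ n (3 * j) _ ⟩
    3 * j * card (covered matching)
      ≤⟨ *-monoʳ-≤ (3 * j) (card-covered matching) ⟩
    3 * j * (2 * size) ∎
  2T≤ : 2 * T ≤ size * m
  2T≤ = begin
    2 * T
      ≡⟨ Σ-*ˡ size 2 (λ i → edgeCount (class i)) ⟨
    Σ< size (λ i → 2 * edgeCount (class i))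
      ≤⟨ Σ-mono-≤ size (λ i → ≤-trans (2*edgeCount-colourClass≤card c proper sup _) card≤m) ⟩
    Σ< size (λ _ → m)
      ≡⟨ Σ-const size m ⟩
    size * m ∎

upper-bound : ∀ j {n} (G : Graph n) (c : EdgeColouring G) → Proper c →
  ∀ {A} → Supported G A → ∀ m → card A ≤ m → 14 * j ≤ m →
  ¬ Σ (MatchingCopy G (suc j)) (Rainbow c) → edgeCount G ≤ j C 2 + j * (m ∸ j)
upper-bound j G c proper sup m card≤m 14j≤m none with any? (λ x → 3 * j <? deg G x)
... | no low =
  ≤-trans (bounded-degree-bound j G c proper sup m card≤m 14j≤m (λ x → ≮⇒≥ λ high → low (x , high)) none)
          (m≤n+m _ (j C 2))
upper-bound zero G c proper sup m _ _ none | yes (x , high) =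
  ⊥-elim (none (extend-at-high-degree c proper emptyMatching (λ ()) (λ ()) high))
upper-bound (suc j) G c proper {A} sup m card≤m 14j≤m none | yes (x , high) = begin
  edgeCount G                              ≤⟨ edgeCount-≤-deg+∖ G x ⟩
  deg G x + edgeCount (G ∖ ｛ x ｝)         ≤⟨ +-mono-≤ (≤-trans (deg-≤-card G sup x) card′≤) rest ⟩
  (m ∸ 1) + (j C 2 + j * (m ∸ 1 ∸ j))      ≡⟨ C2-step j m (≤-trans (m≤n*m (suc j) 14) 14j≤m) ⟩
  suc j C 2 + suc j * (m ∸ suc j)          ∎
  where
  open ≤-Reasoning
  Ax : A x ≡ true
  Ax with A x in outside
  ... | true  = refl
  ... | false = ⊥-elim (<⇒≱ high (≤-trans (≤-reflexive (deg-outside G sup outside)) z≤n))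
  card′≤ : card (A − ｛ x ｝) ≤ m ∸ 1
  card′≤ = ∸-monoˡ-≤ 1 (subst (_≤ m) (card-remove A Ax) card≤m)
  rest : edgeCount (G ∖ ｛ x ｝) ≤ j C 2 + j * (m ∸ 1 ∸ j)
  rest = upper-bound j (G ∖ ｛ x ｝) (restrict (G ∖ ｛ x ｝) (∖-⊆ G ｛ x ｝) c)
           (restrict-proper (G ∖ ｛ x ｝) (∖-⊆ G ｛ x ｝) {c} proper) (∖-supported G sup ｛ x ｝)
           (m ∸ 1) card′≤ (<⇒≤pred (<-≤-trans (*-monoʳ-< 14 (n<1+n j)) 14j≤m))
           λ (M , rainbow) → none (extend-at-high-degree c proper (mapMatching (∖-⊆ G ｛ x ｝) M)
                                     rainbow (∖-avoids-matching G ｛ x ｝ M (dec-true (x ≟ᶠ x) refl)) high)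

-- The extremal graph

no-matching-beyond-cover : ∀ {n j} (G : Graph n) (ι : Fin j → Fin n) →
  (∀ {u v} → Edge G u v → ∃ λ f → ι f ≡ u ⊎ ι f ≡ v) → ¬ MatchingCopy G (suc j)
no-matching-beyond-cover G ι cover M with pigeonhole (n<1+n _) (proj₁ ∘ cover ∘ isEdge M)
... | i , i′ , i<i′ , same = clash (proj₂ (cover (isEdge M i)))
  (subst (λ f → ι f ≡ a M i′ ⊎ ι f ≡ b M i′) (sym same) (proj₂ (cover (isEdge M i′))))
  where
  i≢i′ : i ≢ i′
  i≢i′ = <⇒≢ᶠ i<i′
  clash : ∀ {w} → w ≡ a M i ⊎ w ≡ b M i → w ≡ a M i′ ⊎ w ≡ b M i′ → ⊥
  clash (inj₁ p) (inj₁ q) = i≢i′ (aInj M i i′ (trans (sym p) q))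
  clash (inj₁ p) (inj₂ q) = abDisj M i i′ (trans (sym p) q)
  clash (inj₂ p) (inj₁ q) = abDisj M i′ i (trans (sym q) p)
  clash (inj₂ p) (inj₂ q) = i≢i′ (bInj M i i′ (trans (sym p) q))

completeSplit : ∀ j n → Graph n
completeSplit j n = record
  { adj   = λ u v → not (does (u ≟ᶠ v)) ∧ (ltB (toℕ u) j ∨ ltB (toℕ v) j)
  ; sym   = λ u v → cong₂ _∧_ (cong not (does-⇔ (mk⇔ sym sym) (u ≟ᶠ v) (v ≟ᶠ u)))
                                (∨-comm (ltB (toℕ u) j) (ltB (toℕ v) j))
  ; irref = λ u → cong (λ b → not b ∧ (ltB (toℕ u) j ∨ ltB (toℕ u) j)) (dec-true (u ≟ᶠ u) refl)
  }

sumColouring : ∀ j n → EdgeColouring (completeSplit j n)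
sumColouring j n = record
  { col = λ u v → toℕ u + toℕ v ; colSym = λ u v _ → +-comm (toℕ u) (toℕ v) }

sumColouring-proper : ∀ j n → Proper (sumColouring j n)
sumColouring-proper j n u v w _ _ v≢w same = v≢w (toℕ-injective (+-cancelˡ-≡ (toℕ u) _ _ same))

inject≤-fromℕ< : ∀ {j n} (j≤n : j ≤ n) {w : Fin n} (w<j : toℕ w < j) →
  inject≤ (fromℕ< w<j) j≤n ≡ w
inject≤-fromℕ< j≤n w<j = toℕ-injective (trans (toℕ-inject≤ _ j≤n) (toℕ-fromℕ< w<j))

completeSplit-cover : ∀ {j n} (j≤n : j ≤ n) {u v} → Edge (completeSplit j n) u v →
  ∃ λ f → inject≤ f j≤n ≡ u ⊎ inject≤ f j≤n ≡ v
completeSplit-cover {j} j≤n {u} {v} e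
  with ltB (toℕ u) j in u<j | ltB (toℕ v) j in v<j | ∧-trueʳ (not (does (u ≟ᶠ v))) e
... | true  | _    | _ = fromℕ< (ltB-sound u<j) , inj₁ (inject≤-fromℕ< j≤n (ltB-sound u<j))
... | false | true | _ = fromℕ< (ltB-sound v<j) , inj₂ (inject≤-fromℕ< j≤n (ltB-sound v<j))
... | false | false | ()

ltB-∨ : ∀ {a b} j → a < b → ltB a j ∨ ltB b j ≡ ltB a j
ltB-∨ {a} j a<b with a <? j
... | yes a<j rewrite ltB-< a<j = refl
... | no  a≮j rewrite ltB-≥ (≮⇒≥ a≮j) | ltB-≥ (≤-trans (≮⇒≥ a≮j) (<⇒≤ a<b)) = refl

forwardEdge-completeSplit : ∀ j n u v →
  forwardEdge (completeSplit j n) u v ≡ b2n (ltB (toℕ u) j) * b2n (ltB (toℕ u) (toℕ v))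
forwardEdge-completeSplit j n u v with <-cmp (toℕ u) (toℕ v)
... | tri< u<v _ _
  rewrite ltB-< u<v | dec-false (u ≟ᶠ v) (λ u≡v → <-irrefl (cong toℕ u≡v) u<v) | ltB-∨ j u<v
  = sym (*-identityʳ _)
... | tri≈ u≮v _ _ rewrite ltB-≥ (≮⇒≥ u≮v) = sym (*-zeroʳ (b2n (ltB (toℕ u) j)))
... | tri> u≮v _ _ rewrite ltB-≥ (≮⇒≥ u≮v) = sym (*-zeroʳ (b2n (ltB (toℕ u) j)))

card-above : ∀ n a → Σ< n (λ v → b2n (ltB a (toℕ v))) ≡ n ∸ suc a
card-above zero    a       = refl
card-above (suc n) zero    = trans (Σ-const n 1) (*-identityʳ n)
card-above (suc n) (suc a) = card-above n a

Σ-clique-degrees : ∀ n j → j ≤ n →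
  Σ< n (λ u → b2n (ltB (toℕ u) j) * (n ∸ suc (toℕ u))) ≡ j C 2 + j * (n ∸ j)
Σ-clique-degrees n zero _ =
  trans (sum-cong-≗ {n} λ u → cong (λ b → b2n b * (n ∸ suc (toℕ u))) (ltB-≥ {toℕ u} z≤n))
        (trans (Σ-const n 0) (*-zeroʳ n))
Σ-clique-degrees (suc n) (suc j) (s≤s j≤n) =
  trans (cong₂ _+_ (*-identityˡ n) (Σ-clique-degrees n j j≤n)) (C2-step j (suc n) (s≤s j≤n))

edgeCount-completeSplit : ∀ {j n} → j ≤ n → edgeCount (completeSplit j n) ≡ j C 2 + j * (n ∸ j)
edgeCount-completeSplit {j} {n} j≤n = trans (sum-cong-≗ row) (Σ-clique-degrees n j j≤n)
  where
  row : ∀ u → Σ< n (forwardEdge (completeSplit j n) u) ≡ b2n (ltB (toℕ u) j) * (n ∸ suc (toℕ u))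
  row u = begin
    Σ< n (forwardEdge (completeSplit j n) u)
      ≡⟨ sum-cong-≗ (forwardEdge-completeSplit j n u) ⟩
    Σ< n (λ v → b2n (ltB (toℕ u) j) * b2n (ltB (toℕ u) (toℕ v)))
      ≡⟨ Σ-*ˡ n (b2n (ltB (toℕ u) j)) _ ⟩
    b2n (ltB (toℕ u) j) * Σ< n (λ v → b2n (ltB (toℕ u) (toℕ v)))
      ≡⟨ cong (b2n (ltB (toℕ u) j) *_) (card-above n (toℕ u)) ⟩
    b2n (ltB (toℕ u) j) * (n ∸ suc (toℕ u)) ∎
    where open ≡-Reasoning

completeSplit-extremal : ∀ {j n} → j ≤ n →
  Σ (Graph n) λ G → AdmitsNoRainbowMatching G (suc j) × edgeCount G ≡ j C 2 + j * (n ∸ j)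
completeSplit-extremal {j} {n} j≤n =
  completeSplit j n
  , ( sumColouring j n , sumColouring-proper j n
    , λ (M , _) → no-matching-beyond-cover (completeSplit j n) _ (completeSplit-cover j≤n) M )
  , edgeCount-completeSplit j≤n

theorem2 : ∀ (k n : ℕ) → 1 ≤ k → 1 ≤ n → 9 * (k * k) ≤ n →
    IsRainbowTuranNumberMatching n k (((k ∸ 1) C 2) + (k ∸ 1) * (n ∸ k + 1))
theorem2 (suc j) n _ _ 9k²≤n =
  subst (IsRainbowTuranNumberMatching n (suc j)) (cong (λ d → j C 2 + j * d) (sym (∸-suc+1 k≤n)))
    ( completeSplit-extremal (≤-trans (n≤1+n j) k≤n)
    , λ G (c , proper , none) →
        upper-bound j G c proper {λ _ → true} (λ _ → refl) n card≤n 14j≤n none )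
  where
  k≤n : suc j ≤ n
  k≤n = ≤-trans (m≤m*n (suc j) (suc j)) (≤-trans (m≤n*m _ 9) 9k²≤n)
  14j≤n : 14 * j ≤ n
  14j≤n = ≤-trans (threshold j) 9k²≤n
  card≤n : card {n} (λ _ → true) ≤ n
  card≤n = ≤-reflexive (trans (Σ-const n 1) (*-identityʳ n))
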